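{- Let $p\geq 3$ be a prime. Suppose there exists a covering system of the integers whose moduli are all odd, square-free, greater than $1$, and pairwise distinct, except that $p$ is used exactly twice as a modulus. Then there exists an odd covering system of the integers, i.e. a covering system of the integers whose moduli are all odd, pairwise distinct, and greater than $1$.
   Context: A covering system of the integers is a finite collection of congruences $x\equiv r_j \pmod{m_j}$ such that every integer satisfies at least one of them. "$p$ is used exactly twice as a modulus" means exactly two congruences of the system have modulus $p$. -}

module Defs where

open import Data.Nat using (ℕ; _*_; _>_)
open import Data.Nat.Properties using (_≟_)
open import Data.Nat.Divisibility using () renaming (_∣_ to _∣ℕ_)
open import Data.Integer using (ℤ; +_; _-_)
open import Data.Integer.Divisibility using (_∣_)
open import Data.List using (List; map; filter; length)
open import Data.List.Relation.Unary.Any using (Any)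
open import Data.List.Relation.Unary.All using (All)
open import Data.List.Relation.Unary.Unique.Propositional using (Unique)
open import Data.Product using (_×_; proj₁; proj₂)
open import Relation.Binary.PropositionalEquality using (_≡_)
open import Relation.Nullary using (¬_; ¬?)

Congruence : Set
Congruence = ℤ × ℕ

residue : Congruence → ℤ
residue = proj₁

modulus : Congruence → ℕ
modulus = proj₂

Satisfies : ℤ → Congruence → Set
Satisfies x c = (+ modulus c) ∣ (x - residue c)

Covers : List Congruence → Set
Covers cs = (x : ℤ) → Any (Satisfies x) cs

moduli : List Congruence → List ℕ
moduli cs = map modulus cs

Odd : ℕ → Set
Odd m = ¬ (2 ∣ℕ m)

SquareFree : ℕ → Set
SquareFree m = (d : ℕ) → (d * d) ∣ℕ m → d ≡ 1

OddCovering : List Congruence → Set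
OddCovering cs =
  Covers cs × All (λ m → Odd m × m > 1) (moduli cs) × Unique (moduli cs)

SquareFreeCoveringWithPTwice : ℕ → List Congruence → Set
SquareFreeCoveringWithPTwice p cs =
  Covers cs
  × All (λ m → Odd m × SquareFree m × m > 1) (moduli cs)
  × length (filter (_≟ p) (moduli cs)) ≡ 2
  × Unique (filter (λ m → ¬? (m ≟ p)) (moduli cs))

module Submission where

-- Fix one of the two congruences r₂ (mod p) and drop it: the remaining moduli are distinct
-- and split into C₀ (p ∤ m) and Cₚ (p ∣ m, so m = p n with p ∤ n). Let
-- h j = r₂ (1 + p + ⋯ + p^(j-1)) and take q odd, prime to p and larger than every modulus.
-- Every integer x either satisfies x ≡ h q (mod p^q), or there is a first j < q with
-- x ≡ h j (mod p^j) and x ≢ h (j+1) (mod p^(j+1)), i.e. x = h j + p^j w with w ≢ r₂ (mod p).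
-- In the second case pick, by the Chinese remainder theorem, y ≡ w (mod p) and y ≡ x modulo q
-- and the p-free parts of all moduli. Some congruence a (mod m) covers y, and it is not
-- r₂ (mod p). If p ∤ m then x ≡ a (mod m); otherwise x ≡ h j + p^j a (mod p^(j+1)) and
-- x ≡ a (mod n), a single congruence modulo p^j m. In the first case, with c = x mod q,
-- x ≡ c (mod q) and x ≡ h c (mod p^c). Hence C₀, the lifts of Cₚ to the moduli p^j m (j < q)
-- and one congruence modulo p^c q for each c < q form an odd covering system; its moduli are
-- distinct because p^e n with p ∤ n determines e and n.

open import Defs
open import Data.Empty using (⊥; ⊥-elim)
open import Data.Nat
  using (ℕ; zero; suc; _^_; _/_; _≤_; _<_; _≥_; _>_; s≤s; z≤n; z<s;
         NonZero; >-nonZero; >-nonZero⁻¹; nonTrivial⇒≢1)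
import Data.Nat.Properties as ℕₚ
open import Data.Nat.DivMod using (m*[n/m]≡n; m/n≤m)
open import Data.Nat.Divisibility
  using (divides; _∣?_; ∣-refl; ∣-trans; ∣1⇒≡1; m∣m*n; n∣m*n; ∣m⇒∣m*n; ∣n⇒∣m*n; ∣m+n∣m⇒∣n;
         *-monoʳ-∣; m/n∣m; m∣n/o⇒m*o∣n)
  renaming (_∣_ to _∣ℕ_)
open import Data.Nat.Coprimality using (Coprime; coprime-divisor; coprime-Bézout)
open import Data.Nat.GCD using (module Bézout)
open import Data.Nat.Primality
  using (Prime; prime[2]; prime⇒nonZero; prime⇒nonTrivial; prime⇒irreducible; euclidsLemma)
open import Data.Nat.ListAction using (product)
open import Data.Nat.ListAction.Properties using (∈⇒≤product; ∈⇒∣product; product≢0)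
open import Data.Integer using (ℤ; +_; 0ℤ; 1ℤ; _%ℕ_; _/ℕ_)
open import Data.Integer.DivMod using (n%ℕd<d; a≡a%ℕn+[a/ℕn]*n)
import Data.Integer.Properties as ℤₚ
open import Data.Integer.Divisibility.Signed as ℤᵈ using (_∣_; divides; ∣ᵤ⇒∣; ∣⇒∣ᵤ)
open import Data.Integer.Coprimality using () renaming (coprime-divisor to coprime-divisorℤ)
open import Data.Integer.Tactic.RingSolver using (solve-∀)
open import Data.List using (List; []; _∷_; _++_; map; filter; length; upTo)
open import Data.List.Properties using (filter-some; map-++; map-∘)
open import Data.List.Membership.Propositional using (_∈_; find; lose)
open import Data.List.Membership.Propositional.Properties
  using (∈-filter⁺; ∈-filter⁻; ∈-map⁺; ∈-map⁻; ∈-++⁺ˡ; ∈-++⁺ʳ; ∈-upTo⁺)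
open import Data.List.Relation.Binary.Sublist.Propositional using (_⊆_; []; _∷_; _∷ʳ_)
open import Data.List.Relation.Binary.Sublist.Propositional.Properties
  using (All-resp-⊆; Any-resp-⊆; filter-⊆; filter⁺; map⁺; length-mono-≤)
open import Data.List.Relation.Unary.Any as Any using (Any; here; there)
open import Data.List.Relation.Unary.All.Properties as AllP using (¬Any⇒All¬)
import Data.List.Relation.Unary.Unique.Propositional.Properties as UP
open import Data.List.Relation.Unary.Unique.Propositional using (Unique)
open import Data.List.Relation.Unary.AllPairs using ([]; _∷_)
open import Data.List.Relation.Unary.All as All using (All; []; _∷_)
open import Data.Product.Properties using (≡-dec)
open import Data.Product using (Σ; ∃; ∃-syntax; _×_; _,_; proj₁; proj₂)
open import Data.Sum using (_⊎_; inj₁; inj₂; [_,_]′)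
open import Function using (_∘_; id)
open import Relation.Binary.PropositionalEquality
open import Relation.Nullary using (¬_; ¬?; Dec; yes; no)
open import Relation.Nullary.Decidable using (map′)
open import Relation.Unary using (Decidable)
open import Relation.Binary.Definitions using (DecidableEquality)

-- Natural numbers

module _ where
  open import Data.Nat using (_*_)

  coprime-*ˡ : ∀ {a b n} → Coprime a n → Coprime b n → Coprime (a * b) n
  coprime-*ˡ {a} ca cb (d∣ab , d∣n) = cb (coprime-divisor d⊥a d∣ab , d∣n)
    where
    d⊥a : Coprime _ a
    d⊥a (e∣d , e∣a) = ca (e∣a , ∣-trans e∣d d∣n)

  coprime-^ˡ : ∀ {a n} k → Coprime a n → Coprime (a ^ k) n
  coprime-^ˡ zero    _   (d∣1 , _) = ∣1⇒≡1 d∣1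
  coprime-^ˡ (suc k) a⊥n = coprime-*ˡ a⊥n (coprime-^ˡ k a⊥n)

  odd-* : ∀ {a b} → Odd a → Odd b → Odd (a * b)
  odd-* {a} {b} odd-a odd-b 2∣ab = [ odd-a , odd-b ]′ (euclidsLemma a b prime[2] 2∣ab)

  odd-^ : ∀ {a} k → Odd a → Odd (a ^ k)
  odd-^ zero    _     2∣1 with () ← ∣1⇒≡1 2∣1
  odd-^ (suc k) odd-a = odd-* odd-a (odd-^ k odd-a)

  m∣m^[1+n]*o : ∀ m n o → m ∣ℕ m ^ suc n * o
  m∣m^[1+n]*o m n o = ∣m⇒∣m*n o (m∣m*n (m ^ n))

  ^-monoʳ-∣ : ∀ p {a b} → a ≤ b → p ^ a ∣ℕ p ^ b
  ^-monoʳ-∣ p {b = b} z≤n   = divides (p ^ b) (sym (ℕₚ.*-identityʳ (p ^ b)))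
  ^-monoʳ-∣ p (s≤s a≤b) = *-monoʳ-∣ p (^-monoʳ-∣ p a≤b)

  module _ {p : ℕ} (p-prime : Prime p) where

    private instance
      p≢0 : NonZero p
      p≢0 = prime⇒nonZero p-prime

    prime∤⇒coprime : ∀ {n} → ¬ p ∣ℕ n → Coprime p n
    prime∤⇒coprime p∤n (d∣p , d∣n) with prime⇒irreducible p-prime d∣p
    ... | inj₁ d≡1 = d≡1
    ... | inj₂ refl = ⊥-elim (p∤n d∣n)

    prime∤1 : ¬ p ∣ℕ 1
    prime∤1 = nonTrivial⇒≢1 {{prime⇒nonTrivial p-prime}} ∘ ∣1⇒≡1

    prime∤-* : ∀ {m n} → ¬ p ∣ℕ m → ¬ p ∣ℕ n → ¬ p ∣ℕ m * n
    prime∤-* {m} {n} p∤m p∤n p∣mn = [ p∤m , p∤n ]′ (euclidsLemma m n p-prime p∣mn)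

    prime∤-product : ∀ {ns} → All (λ n → ¬ p ∣ℕ n) ns → ¬ p ∣ℕ product ns
    prime∤-product []           = prime∤1
    prime∤-product (p∤n ∷ p∤ns) = prime∤-* p∤n (prime∤-product p∤ns)

    ^*-injective : ∀ {a b u v} → ¬ p ∣ℕ u → ¬ p ∣ℕ v →
                   p ^ a * u ≡ p ^ b * v → a ≡ b × u ≡ v
    ^*-injective {zero}  {zero}  {u} {v} _ _ eq =
      refl , trans (sym (ℕₚ.*-identityˡ u)) (trans eq (ℕₚ.*-identityˡ v))
    ^*-injective {zero}  {suc b} {u} {v} p∤u _ eq =
      ⊥-elim (p∤u (subst (p ∣ℕ_) (trans (sym eq) (ℕₚ.*-identityˡ u))
                         (m∣m^[1+n]*o p b v)))
    ^*-injective {suc a} {zero}  {u} {v} _ p∤v eq =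
      ⊥-elim (p∤v (subst (p ∣ℕ_) (trans eq (ℕₚ.*-identityˡ v))
                         (m∣m^[1+n]*o p a u)))
    ^*-injective {suc a} {suc b} {u} {v} p∤u p∤v eq
      with refl , u≡v ← ^*-injective {a} {b} p∤u p∤v (ℕₚ.*-cancelˡ-≡ _ _ p
                           (trans (sym (ℕₚ.*-assoc p _ u)) (trans eq (ℕₚ.*-assoc p _ v))))
      = refl , u≡v

    squareFree⇒∤quotient : ∀ {m} → SquareFree m → p ∣ℕ m → ¬ p ∣ℕ m / p
    squareFree⇒∤quotient sf p∣m p∣m/p =
      nonTrivial⇒≢1 {{prime⇒nonTrivial p-prime}} (sf p (m∣n/o⇒m*o∣n p∣m p∣m/p))

first-failure : ∀ {Q : ℕ → Set} → Decidable Q → Q 0 → ∀ k →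
                Q k ⊎ ∃[ j ] j < k × Q j × ¬ Q (suc j)
first-failure Q? Q0 zero = inj₁ Q0
first-failure Q? Q0 (suc k) with first-failure Q? Q0 k
... | inj₂ (j , j<k , Qj , ¬Qj+1) = inj₂ (j , ℕₚ.m<n⇒m<1+n j<k , Qj , ¬Qj+1)
... | inj₁ Qk with Q? (suc k)
...   | yes Qk+1 = inj₁ Qk+1
...   | no ¬Qk+1 = inj₂ (k , ℕₚ.n<1+n k , Qk , ¬Qk+1)

-- Congruences of integers

module _ where
  open import Data.Integer using (_+_; _-_; _*_; -_)
  open import Data.Nat using () renaming (_*_ to _ℕ*_; _+_ to _ℕ+_)

  infix 4 _≡_mod_ _≡?_mod_

  -- A record rather than a function, so that x, y and m can be inferred from the type.
  record _≡_mod_ (x y : ℤ) (m : ℕ) : Set where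
    constructor ≡-mod
    field modulus∣difference : + m ∣ x - y

  ≡-mod-from : ∀ {m x y} z w → + m ∣ z → x - y ≡ w * z → x ≡ y mod m
  ≡-mod-from z w m∣z eq = ≡-mod (subst (_ ∣_) (sym eq) (ℤᵈ.∣n⇒∣m*n w m∣z))

  ≡-mod-refl : ∀ {m x} → x ≡ x mod m
  ≡-mod-refl {m} {x} = ≡-mod-from (+ m) 0ℤ ℤᵈ.∣-refl (x-x≡0*m x (+ m))
    where
    x-x≡0*m : ∀ x m → x - x ≡ 0ℤ * m
    x-x≡0*m = solve-∀

  ≡-mod-sym : ∀ {m x y} → x ≡ y mod m → y ≡ x mod m
  ≡-mod-sym {x = x} {y} (≡-mod m∣x-y) =
    ≡-mod-from (x - y) (- 1ℤ) m∣x-y (y-x≡-1*[x-y] x y)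
    where
    y-x≡-1*[x-y] : ∀ x y → y - x ≡ - 1ℤ * (x - y)
    y-x≡-1*[x-y] = solve-∀

  ≡-mod-trans : ∀ {m x y z} → x ≡ y mod m → y ≡ z mod m → x ≡ z mod m
  ≡-mod-trans {x = x} {y} {z} (≡-mod m∣x-y) (≡-mod m∣y-z) =
    ≡-mod (subst (_ ∣_) (telescope x y z) (ℤᵈ.∣m∣n⇒∣m+n m∣x-y m∣y-z))
    where
    telescope : ∀ x y z → (x - y) + (y - z) ≡ x - z
    telescope = solve-∀

  ≡-mod-∣ : ∀ {d m x y} → d ∣ℕ m → x ≡ y mod m → x ≡ y mod d
  ≡-mod-∣ d∣m (≡-mod m∣x-y) = ≡-mod (ℤᵈ.∣-trans (∣ᵤ⇒∣ d∣m) m∣x-y)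

  ≡-mod-*ʳ : ∀ {m x y} k → x ≡ y mod m → x * + k ≡ y * + k mod m ℕ* k
  ≡-mod-*ʳ {m} {x} {y} k (≡-mod m∣x-y) =
    ≡-mod (subst₂ _∣_ (sym (ℤₚ.pos-* m k)) ([x-y]*k≡x*k-y*k x y (+ k))
                  (ℤᵈ.*-monoˡ-∣ (+ k) m∣x-y))
    where
    [x-y]*k≡x*k-y*k : ∀ x y k → (x - y) * k ≡ x * k - y * k
    [x-y]*k≡x*k-y*k = solve-∀

  ≡-mod-crt : ∀ {m n x y} → Coprime m n →
              x ≡ y mod m → x ≡ y mod n → x ≡ y mod m ℕ* n
  ≡-mod-crt {m} {n} m⊥n (≡-mod m∣x-y) (≡-mod (divides k x-y≡k*n)) =
    ≡-mod (subst₂ _∣_ (sym (ℤₚ.pos-* m n)) (sym x-y≡k*n)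
                  (ℤᵈ.*-monoˡ-∣ (+ n) m∣k))
    where
    m∣n*k : + m ∣ + n * k
    m∣n*k = subst (+ m ∣_) (trans x-y≡k*n (ℤₚ.*-comm k (+ n))) m∣x-y
    m∣k : + m ∣ k
    m∣k = ∣ᵤ⇒∣ (coprime-divisorℤ (+ m) (+ n) k m⊥n (∣⇒∣ᵤ m∣n*k))

  ≡-mod-one : ∀ {x y} → x ≡ y mod 1
  ≡-mod-one {x} {y} = ≡-mod (divides (x - y) (sym (ℤₚ.*-identityʳ (x - y))))

  _≡?_mod_ : ∀ x y m → Dec (x ≡ y mod m)
  x ≡? y mod m = map′ ≡-mod _≡_mod_.modulus∣difference (+ m ℤᵈ.∣? x - y)

  satisfies : ∀ {x r m} → x ≡ r mod m → Satisfies x (r , m)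
  satisfies (≡-mod m∣x-r) = ∣⇒∣ᵤ m∣x-r

  satisfies⁻¹ : ∀ {x r m} → Satisfies x (r , m) → x ≡ r mod m
  satisfies⁻¹ m∣x-r = ≡-mod (∣ᵤ⇒∣ m∣x-r)

  ∃-idempotent : ∀ {m n} → Coprime m n → ∃ λ K → K ≡ 0ℤ mod n × K ≡ 1ℤ mod m
  ∃-idempotent {m} {n} m⊥n with coprime-Bézout m⊥n
  ... | Bézout.-+ x y 1+xm≡yn =
    + y * + n , ≡-mod-from (+ n) (+ y) ℤᵈ.∣-refl (t-0≡t (+ y * + n)) ,
    ≡-mod-from (+ m) (+ x) ℤᵈ.∣-refl (begin
      + y * + n - 1ℤ          ≡⟨ cong (_- 1ℤ) yn≡1+xm ⟩
      (1ℤ + + x * + m) - 1ℤ   ≡⟨ [1+t]-1≡t (+ x * + m) ⟩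
      + x * + m               ∎)
    where
    open ≡-Reasoning
    yn≡1+xm : + y * + n ≡ 1ℤ + + x * + m
    yn≡1+xm = begin
      + y * + n         ≡⟨ ℤₚ.pos-* y n ⟨
      + (y ℕ* n)        ≡⟨ cong +_ 1+xm≡yn ⟨
      + (1 ℕ+ x ℕ* m)   ≡⟨ cong (_+_ 1ℤ) (ℤₚ.pos-* x m) ⟩
      1ℤ + + x * + m    ∎
    t-0≡t : ∀ t → t - 0ℤ ≡ t
    t-0≡t = solve-∀
    [1+t]-1≡t : ∀ t → (1ℤ + t) - 1ℤ ≡ t
    [1+t]-1≡t = solve-∀
  ... | Bézout.+- x y 1+yn≡xm =
    - (+ y * + n) , ≡-mod-from (+ n) (- + y) ℤᵈ.∣-refl (-[y*n]-0≡-y*n (+ y) (+ n)) ,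
    ≡-mod-from (+ m) (- + x) ℤᵈ.∣-refl (begin
      - (+ y * + n) - 1ℤ      ≡⟨ -t-1≡-[1+t] (+ y * + n) ⟩
      - (1ℤ + + y * + n)      ≡⟨ cong -_ 1+yn≡xm′ ⟩
      - (+ x * + m)           ≡⟨ ℤₚ.neg-distribˡ-* (+ x) (+ m) ⟩
      - + x * + m             ∎)
    where
    open ≡-Reasoning
    1+yn≡xm′ : 1ℤ + + y * + n ≡ + x * + m
    1+yn≡xm′ = begin
      1ℤ + + y * + n    ≡⟨ cong (_+_ 1ℤ) (ℤₚ.pos-* y n) ⟨
      + (1 ℕ+ y ℕ* n)   ≡⟨ cong +_ 1+yn≡xm ⟩
      + (x ℕ* m)        ≡⟨ ℤₚ.pos-* x m ⟩
      + x * + m         ∎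
    -[y*n]-0≡-y*n : ∀ y n → - (y * n) - 0ℤ ≡ - y * n
    -[y*n]-0≡-y*n = solve-∀
    -t-1≡-[1+t] : ∀ t → - t - 1ℤ ≡ - (1ℤ + t)
    -t-1≡-[1+t] = solve-∀

  module Gluing (K : ℤ) where

    glue : ℤ → ℤ → ℤ
    glue u v = u + (v - u) * K

    glue-≡ˡ : ∀ {n} u v → K ≡ 0ℤ mod n → glue u v ≡ u mod n
    glue-≡ˡ u v (≡-mod n∣K) = ≡-mod-from (K - 0ℤ) (v - u) n∣K (difference u v K)
      where
      difference : ∀ u v K → (u + (v - u) * K) - u ≡ (v - u) * (K - 0ℤ)
      difference = solve-∀

    glue-≡ʳ : ∀ {n} u v → K ≡ 1ℤ mod n → glue u v ≡ v mod n
    glue-≡ʳ u v (≡-mod n∣K-1) = ≡-mod-from (K - 1ℤ) (v - u) n∣K-1 (difference u v K)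
      where
      difference : ∀ u v K → (u + (v - u) * K) - v ≡ (v - u) * (K - 1ℤ)
      difference = solve-∀

-- Lists

length≡suc⇒∃∈ : ∀ {A : Set} (xs : List A) {n} → length xs ≡ suc n → ∃ (_∈ xs)
length≡suc⇒∃∈ (x ∷ _) _ = x , here refl

Unique-resp-⊆ : ∀ {A : Set} {xs ys : List A} → xs ⊆ ys → Unique ys → Unique xs
Unique-resp-⊆ []         []          = []
Unique-resp-⊆ (_ ∷ʳ τ)   (_ ∷ u)     = Unique-resp-⊆ τ u
Unique-resp-⊆ (refl ∷ τ) (x∉ys ∷ u) = All-resp-⊆ τ x∉ys ∷ Unique-resp-⊆ τ u

module _ {B : Set} (_≟_ : DecidableEquality B) where

  Unique-if-rare : ∀ b ys → length (filter (_≟ b) ys) ≤ 1 →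
                   Unique (filter (λ y → ¬? (y ≟ b)) ys) → Unique ys
  Unique-if-rare b []       _ _ = []
  Unique-if-rare b (y ∷ ys) few u with y ≟ b
  Unique-if-rare b (y ∷ ys) (s≤s none) u | yes refl =
    ¬Any⇒All¬ ys (λ b∈ys → ℕₚ.<⇒≱ (filter-some (_≟ b) (Any.map sym b∈ys)) none)
    ∷ 
    Unique-if-rare b ys (ℕₚ.m≤n⇒m≤1+n none) u
  Unique-if-rare b (y ∷ ys) few (y∉ ∷ u) | no y≢b =
    All.tabulate (λ {z} z∈ys y≡z → All.lookup y∉ (∈-filter⁺ _ z∈ys (y≢b ∘ trans y≡z)) y≡z)
    ∷ 
    Unique-if-rare b ys few u

module _ {A B : Set} (_≟ᴬ_ : DecidableEquality A) (_≟ᴮ_ : DecidableEquality B)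
         (f : A → B) where

  private
    count : B → List A → ℕ
    count b xs = length (filter (_≟ᴮ b) (map f xs))

    delete : A → List A → List A
    delete x = filter (λ y → ¬? (y ≟ᴬ x))

  count-delete≤ : ∀ b x xs → count b (delete x xs) ≤ count b xs
  count-delete≤ b x xs =
    length-mono-≤ (filter⁺ (_≟ᴮ b) (_≟ᴮ b) (λ { refl → id })
                           (map⁺ f (filter-⊆ _ xs)))

  count-delete< : ∀ {x xs} → x ∈ xs → count (f x) (delete x xs) < count (f x) xs
  count-delete< {x} {y ∷ ys} _ with y ≟ᴬ x
  ... | yes refl with f y ≟ᴮ f y
  ...   | yes _     = s≤s (count-delete≤ (f y) y ys)
  ...   | no fy≢fy = ⊥-elim (fy≢fy refl)
  count-delete< {x} {y ∷ ys} (here x≡y) | no y≢x = ⊥-elim (y≢x (sym x≡y))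
  count-delete< {x} {y ∷ ys} (there x∈ys) | no y≢x with f y ≟ᴮ f x
  ... | yes _ = s≤s (count-delete< x∈ys)
  ... | no _  = count-delete< x∈ys

Unique-map-++ : ∀ {A B : Set} {P Q : B → Set} (f : A → B) {xs ys : List A} →
                Unique (map f xs) → Unique (map f ys) →
                All (P ∘ f) xs → All (Q ∘ f) ys → (∀ {b} → P b → Q b → ⊥) →
                Unique (map f (xs ++ ys))
Unique-map-++ f {xs} {ys} u v Pxs Qys P⇒¬Q = subst Unique (sym (map-++ f xs ys))
  (UP.++⁺ u v λ {b} (b∈xs , b∈ys) →
    P⇒¬Q {b} (All.lookup (AllP.map⁺ Pxs) b∈xs) (All.lookup (AllP.map⁺ Qys) b∈ys))

-- The odd covering system

_≟ᶜ_ : DecidableEquality Congruence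
_≟ᶜ_ = ≡-dec ℤₚ._≟_ ℕₚ._≟_

module Construction
  {p : ℕ} (p-prime : Prime p) (odd-p : Odd p)
  (cs : List Congruence) (covers : Covers cs)
  (moduli-ok : All (λ m → Odd m × SquareFree m × m > 1) (moduli cs))
  (r₂ : ℤ) (others-distinct : Unique (moduli (filter (λ c → ¬? (c ≟ᶜ (r₂ , p))) cs)))
  where

  open import Data.Integer using (_+_; _-_; _*_)
  open import Data.Nat using () renaming (_*_ to _ℕ*_)

  private instance
    p≢0 : NonZero p
    p≢0 = prime⇒nonZero p-prime

  others C₀ Cₚ : List Congruence
  others = filter (λ c → ¬? (c ≟ᶜ (r₂ , p))) cs
  C₀ = filter (λ c → ¬? (p ∣? modulus c)) others
  Cₚ = filter (λ c → p ∣? modulus c) others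

  others⊆cs : others ⊆ cs
  others⊆cs = filter-⊆ _ cs

  C₀⊆others : C₀ ⊆ others
  C₀⊆others = filter-⊆ _ others

  Cₚ⊆others : Cₚ ⊆ others
  Cₚ⊆others = filter-⊆ _ others

  all-ok : All (λ c → Odd (modulus c) × SquareFree (modulus c) × modulus c > 1) cs
  all-ok = AllP.map⁻ moduli-ok

  P : ℕ
  P = product (moduli cs)

  q : ℕ
  q = suc (2 ℕ* p ℕ* P)

  moduli-nonZero : All NonZero (moduli cs)
  moduli-nonZero = All.map (λ (_ , _ , m>1) → >-nonZero (ℕₚ.<-trans z<s m>1)) moduli-ok

  modulus≤P : ∀ {c} → c ∈ cs → modulus c ≤ P
  modulus≤P = ∈⇒≤product moduli-nonZero ∘ ∈-map⁺ modulus

  P<q : P < q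
  P<q = s≤s (ℕₚ.m≤n*m P (2 ℕ* p) {{ℕₚ.m*n≢0 2 p}})

  modulus<q : ∀ {c} → c ∈ cs → modulus c < q
  modulus<q c∈cs = ℕₚ.≤-<-trans (modulus≤P c∈cs) P<q

  q>1 : q > 1
  q>1 = ℕₚ.≤-<-trans (>-nonZero⁻¹ P {{product≢0 moduli-nonZero}}) P<q

  ∣q∣2pP⇒∣1 : ∀ {d} → d ∣ℕ q → d ∣ℕ 2 ℕ* p ℕ* P → d ∣ℕ 1
  ∣q∣2pP⇒∣1 {d} d∣q =
    ∣m+n∣m⇒∣n (subst (d ∣ℕ_) (ℕₚ.+-comm 1 (2 ℕ* p ℕ* P)) d∣q)

  p∤q : ¬ p ∣ℕ q
  p∤q p∣q = prime∤1 p-prime (∣q∣2pP⇒∣1 p∣q (∣m⇒∣m*n P (n∣m*n 2)))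

  odd-q : Odd q
  odd-q 2∣q with () ← ∣1⇒≡1 (∣q∣2pP⇒∣1 2∣q (∣m⇒∣m*n P (m∣m*n p)))

  ∈C₀⇒ : ∀ {c} → c ∈ C₀ → c ∈ cs × ¬ p ∣ℕ modulus c
  ∈C₀⇒ c∈C₀
    with c∈others , p∤m ← ∈-filter⁻ (λ c → ¬? (p ∣? modulus c)) c∈C₀ =
    Any-resp-⊆ others⊆cs c∈others , p∤m

  ∈Cₚ⇒ : ∀ {c} → c ∈ Cₚ → c ∈ cs × p ∣ℕ modulus c
  ∈Cₚ⇒ c∈Cₚ
    with c∈others , p∣m ← ∈-filter⁻ (λ c → p ∣? modulus c) c∈Cₚ =
    Any-resp-⊆ others⊆cs c∈others , p∣m

  ∈others⁺ : ∀ {c} → c ∈ cs → c ≢ (r₂ , p) → c ∈ others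
  ∈others⁺ = ∈-filter⁺ (λ c → ¬? (c ≟ᶜ (r₂ , p)))

  ∈C₀⁺ : ∀ {c} → c ∈ cs → c ≢ (r₂ , p) → ¬ p ∣ℕ modulus c → c ∈ C₀
  ∈C₀⁺ c∈cs c≢c₂ =
    ∈-filter⁺ (λ c → ¬? (p ∣? modulus c)) (∈others⁺ c∈cs c≢c₂)

  ∈Cₚ⁺ : ∀ {c} → c ∈ cs → c ≢ (r₂ , p) → p ∣ℕ modulus c → c ∈ Cₚ
  ∈Cₚ⁺ c∈cs c≢c₂ =
    ∈-filter⁺ (λ c → p ∣? modulus c) (∈others⁺ c∈cs c≢c₂)

  p∤cofactor : ∀ {c} → c ∈ Cₚ → ¬ p ∣ℕ modulus c / p
  p∤cofactor c∈Cₚ with c∈cs , p∣m ← ∈Cₚ⇒ c∈Cₚ =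
    squareFree⇒∤quotient p-prime (proj₁ (proj₂ (All.lookup all-ok c∈cs))) p∣m

  N : ℕ
  N = q ℕ* (product (moduli C₀) ℕ* product (map (_/ p) (moduli Cₚ)))

  p∤N : ¬ p ∣ℕ N
  p∤N = prime∤-* p-prime p∤q (prime∤-* p-prime
    (prime∤-product p-prime (AllP.map⁺ (All.tabulate (proj₂ ∘ ∈C₀⇒))))
    (prime∤-product p-prime (AllP.map⁺ (AllP.map⁺ (All.tabulate p∤cofactor)))))

  q∣N : q ∣ℕ N
  q∣N = m∣m*n _

  C₀-modulus∣N : ∀ {c} → c ∈ C₀ → modulus c ∣ℕ N
  C₀-modulus∣N c∈C₀ = ∣n⇒∣m*n q (∣m⇒∣m*n (product (map (_/ p) (moduli Cₚ)))
    (∈⇒∣product (∈-map⁺ modulus c∈C₀)))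

  Cₚ-cofactor∣N : ∀ {c} → c ∈ Cₚ → modulus c / p ∣ℕ N
  Cₚ-cofactor∣N c∈Cₚ = ∣n⇒∣m*n q (∣n⇒∣m*n (product (moduli C₀))
    (∈⇒∣product (∈-map⁺ (_/ p) (∈-map⁺ modulus c∈Cₚ))))

  -- Opaque, so that type checking never unfolds the Bézout computation behind K.
  opaque
    K-spec : ∃ λ K → K ≡ 0ℤ mod N × K ≡ 1ℤ mod p ^ q
    K-spec = ∃-idempotent (coprime-^ˡ q (prime∤⇒coprime p-prime p∤N))

  open Gluing (proj₁ K-spec)

  glue-≡-cofactor : ∀ {d} u v → d ∣ℕ N → glue u v ≡ u mod d
  glue-≡-cofactor u v d∣N = ≡-mod-∣ d∣N (glue-≡ˡ u v (proj₁ (proj₂ K-spec)))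

  glue-≡-power : ∀ {e} u v → e ≤ q → glue u v ≡ v mod p ^ e
  glue-≡-power u v e≤q =
    ≡-mod-∣ (^-monoʳ-∣ p e≤q) (glue-≡ʳ u v (proj₂ (proj₂ K-spec)))

  glue-satisfies : ∀ {x u v e n} → e ≤ q → ¬ p ∣ℕ n → n ∣ℕ N →
                   x ≡ u mod n → x ≡ v mod p ^ e → Satisfies x (glue u v , p ^ e ℕ* n)
  glue-satisfies {u = u} {v} {e} e≤q p∤n n∣N x≡u x≡v = satisfies (≡-mod-crt
    (coprime-^ˡ e (prime∤⇒coprime p-prime p∤n))
    (≡-mod-trans x≡v (≡-mod-sym (glue-≡-power u v e≤q)))
    (≡-mod-trans x≡u (≡-mod-sym (glue-≡-cofactor u v n∣N))))

  h : ℕ → ℤ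
  h zero    = 0ℤ
  h (suc j) = h j + + (p ^ j) * r₂

  h-≡ : ∀ {i} j → i ≤ j → h j ≡ h i mod p ^ i
  h-≡ j i≤j with ℕₚ.m≤n⇒m<n∨m≡n i≤j
  ... | inj₂ refl = ≡-mod-refl
  h-≡ {i} (suc j) _ | inj₁ (s≤s i≤j) = ≡-mod-trans hj+1≡hj (h-≡ j i≤j)
    where
    [a+b*r]-a≡r*b : ∀ a b r → (a + b * r) - a ≡ r * b
    [a+b*r]-a≡r*b = solve-∀
    hj+1≡hj : h (suc j) ≡ h j mod p ^ i
    hj+1≡hj = ≡-mod-from (+ (p ^ j)) r₂ (∣ᵤ⇒∣ (^-monoʳ-∣ p i≤j))
                         ([a+b*r]-a≡r*b (h j) (+ (p ^ j)) r₂)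

  next-digit : ∀ {x} j {w v} → x - h j ≡ w * + (p ^ j) → w ≡ v mod p →
               x ≡ h j + + (p ^ j) * v mod p ^ suc j
  next-digit {x} j {w} {v} x-hj≡w*pʲ w≡v with ≡-mod d ← ≡-mod-*ʳ (p ^ j) w≡v =
    ≡-mod (subst (_ ∣_) (sym (difference x (h j) (+ (p ^ j)) v w x-hj≡w*pʲ)) d)
    where
    difference : ∀ x a b v w → x - a ≡ w * b → x - (a + b * v) ≡ w * b - v * b
    difference x a b v w eq = begin
      x - (a + b * v)     ≡⟨ rearrange x a b v ⟩
      (x - a) - v * b     ≡⟨ cong (_- v * b) eq ⟩
      w * b - v * b       ∎
      where
      open ≡-Reasoning
      rearrange : ∀ x a b v → x - (a + b * v) ≡ (x - a) - v * b
      rearrange = solve-∀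

  lift : ℕ → Congruence → Congruence
  lift j c = glue (residue c) (h j + + (p ^ j) * residue c) , p ^ j ℕ* modulus c

  levels : ℕ → List Congruence
  levels zero    = []
  levels (suc k) = levels k ++ map (lift k) Cₚ

  final : ℕ → Congruence
  final c = glue (+ c) (h c) , p ^ c ℕ* q

  system : List Congruence
  system = C₀ ++ levels q ++ map final (upTo q)

  lift∈levels : ∀ {j k c} → j < k → c ∈ Cₚ → lift j c ∈ levels k
  lift∈levels {j} {suc k} (s≤s j≤k) c∈Cₚ with ℕₚ.m≤n⇒m<n∨m≡n j≤k
  ... | inj₁ j<k  = ∈-++⁺ˡ (lift∈levels j<k c∈Cₚ)
  ... | inj₂ refl = ∈-++⁺ʳ (levels j) (∈-map⁺ (lift j) c∈Cₚ)

  p^j*m≡p^[1+j]*[m/p] : ∀ j {m} → p ∣ℕ m → p ^ j ℕ* m ≡ p ^ suc j ℕ* (m / p)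
  p^j*m≡p^[1+j]*[m/p] j {m} p∣m = begin
    p ^ j ℕ* m                ≡⟨ cong (p ^ j ℕ*_) (m*[n/m]≡n p∣m) ⟨
    p ^ j ℕ* (p ℕ* (m / p))   ≡⟨ ℕₚ.*-assoc (p ^ j) p (m / p) ⟨
    p ^ j ℕ* p ℕ* (m / p)     ≡⟨ cong (_ℕ* (m / p)) (ℕₚ.*-comm (p ^ j) p) ⟩
    p ^ suc j ℕ* (m / p)      ∎
    where open ≡-Reasoning

  level-covered : ∀ {x j} → j < q →
                  x ≡ h j mod p ^ j → ¬ x ≡ h (suc j) mod p ^ suc j →
                  Any (Satisfies x) system
  level-covered {x} {j} j<q (≡-mod (divides w x-hj≡w*pʲ)) x≢hj+1 = covered (find (covers y))
    where
    y : ℤ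
    y = glue x w

    x≡y : ∀ {d} → d ∣ℕ N → x ≡ y mod d
    x≡y d∣N = ≡-mod-sym (glue-≡-cofactor x w d∣N)

    w≡a : ∀ {a m} → p ∣ℕ m → y ≡ a mod m → w ≡ a mod p
    w≡a p∣m y≡a =
      ≡-mod-trans (≡-mod-sym (≡-mod-∣ (m∣m*n (p ^ j)) (glue-≡-power x w j<q)))
                  (≡-mod-∣ p∣m y≡a)

    covered : (∃ λ c → c ∈ cs × Satisfies y c) → Any (Satisfies x) system
    covered ((a , m) , c∈cs , y-sat) with (a , m) ≟ᶜ (r₂ , p) | p ∣? m
    ... | yes refl | _ =
      ⊥-elim (x≢hj+1 (next-digit j x-hj≡w*pʲ (w≡a ∣-refl (satisfies⁻¹ y-sat))))
    ... | no c≢c₂ | no p∤m =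
      lose (∈-++⁺ˡ c∈C₀)
           (satisfies (≡-mod-trans (x≡y (C₀-modulus∣N c∈C₀)) (satisfies⁻¹ y-sat)))
      where
      c∈C₀ : (a , m) ∈ C₀
      c∈C₀ = ∈C₀⁺ c∈cs c≢c₂ p∤m
    ... | no c≢c₂ | yes p∣m =
      lose (∈-++⁺ʳ C₀ (∈-++⁺ˡ (lift∈levels j<q c∈Cₚ)))
           (subst (λ μ → Satisfies x (glue a (h j + + (p ^ j) * a) , μ))
                  (sym (p^j*m≡p^[1+j]*[m/p] j p∣m))
                  (glue-satisfies j<q (p∤cofactor c∈Cₚ) (Cₚ-cofactor∣N c∈Cₚ)
                                  x≡a x≡hj+pʲa))
      where
      c∈Cₚ : (a , m) ∈ Cₚ
      c∈Cₚ = ∈Cₚ⁺ c∈cs c≢c₂ p∣m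
      y≡a : y ≡ a mod m
      y≡a = satisfies⁻¹ y-sat
      x≡a : x ≡ a mod m / p
      x≡a = ≡-mod-trans (x≡y (Cₚ-cofactor∣N c∈Cₚ)) (≡-mod-∣ (m/n∣m p∣m) y≡a)
      x≡hj+pʲa : x ≡ h j + + (p ^ j) * a mod p ^ suc j
      x≡hj+pʲa = next-digit j x-hj≡w*pʲ (w≡a p∣m y≡a)

  final-covered : ∀ {x} → x ≡ h q mod p ^ q → Any (Satisfies x) system
  final-covered {x} x≡hq =
    lose (∈-++⁺ʳ C₀ (∈-++⁺ʳ (levels q) (∈-map⁺ final (∈-upTo⁺ c<q))))
         (glue-satisfies c≤q p∤q q∣N x≡c x≡hc)
    where
    c : ℕ
    c = x %ℕ q
    c<q : c < q
    c<q = n%ℕd<d x q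
    c≤q : c ≤ q
    c≤q = ℕₚ.<⇒≤ c<q
    x≡c : x ≡ + c mod q
    x≡c = ≡-mod-from (+ q) (x /ℕ q) ℤᵈ.∣-refl (begin
      x - + c                        ≡⟨ cong (_- + c) (a≡a%ℕn+[a/ℕn]*n x q) ⟩
      (+ c + (x /ℕ q) * + q) - + c   ≡⟨ [a+b]-a≡b (+ c) ((x /ℕ q) * + q) ⟩
      (x /ℕ q) * + q                 ∎)
      where
      open ≡-Reasoning
      [a+b]-a≡b : ∀ a b → (a + b) - a ≡ b
      [a+b]-a≡b = solve-∀
    x≡hc : x ≡ h c mod p ^ c
    x≡hc = ≡-mod-trans (≡-mod-∣ (^-monoʳ-∣ p c≤q) x≡hq) (h-≡ q c≤q)

  system-covers : Covers system
  system-covers x with first-failure (λ j → x ≡? h j mod p ^ j) ≡-mod-one q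
  ... | inj₁ x≡hq                         = final-covered x≡hq
  ... | inj₂ (j , j<q , x≡hj , x≢hj+1) = level-covered j<q x≡hj x≢hj+1

  OddAbove1 : ℕ → Set
  OddAbove1 m = Odd m × m > 1

  cs-OddAbove1 : ∀ {c} → c ∈ cs → OddAbove1 (modulus c)
  cs-OddAbove1 c∈cs with odd , _ , m>1 ← All.lookup all-ok c∈cs = odd , m>1

  OddAbove1-p^k* : ∀ k {m} → OddAbove1 m → OddAbove1 (p ^ k ℕ* m)
  OddAbove1-p^k* k {m} (odd-m , m>1) =
    odd-* (odd-^ k odd-p) odd-m ,
    ℕₚ.<-≤-trans m>1 (ℕₚ.m≤n*m m (p ^ k) {{ℕₚ.m^n≢0 p k}})

  levels-OddAbove1 : ∀ k → All (OddAbove1 ∘ modulus) (levels k)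
  levels-OddAbove1 zero    = []
  levels-OddAbove1 (suc k) = AllP.++⁺ (levels-OddAbove1 k)
    (AllP.map⁺ (All.tabulate λ c∈Cₚ →
      OddAbove1-p^k* k (cs-OddAbove1 (proj₁ (∈Cₚ⇒ c∈Cₚ)))))

  system-OddAbove1 : All OddAbove1 (moduli system)
  system-OddAbove1 =
    AllP.map⁺ (AllP.++⁺ C₀-OddAbove1 (AllP.++⁺ (levels-OddAbove1 q) finals-OddAbove1))
    where
    C₀-OddAbove1 : All (OddAbove1 ∘ modulus) C₀
    C₀-OddAbove1 = All.tabulate λ c∈C₀ → cs-OddAbove1 (proj₁ (∈C₀⇒ c∈C₀))
    finals-OddAbove1 : All (OddAbove1 ∘ modulus) (map final (upTo q))
    finals-OddAbove1 = AllP.map⁺ {xs = upTo q} {f = final}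
      (All.tabulate λ {c} _ → OddAbove1-p^k* c (odd-q , q>1))

  record HasCofactor (e μ : ℕ) : Set where
    constructor has-cofactor
    field
      n        : ℕ
      μ≡p^e*n  : μ ≡ p ^ e ℕ* n
      p∤n      : ¬ p ∣ℕ n
      n<q      : n < q

  LevelModulus : ℕ → ℕ → Set
  LevelModulus k μ = ∃[ j ] j < k × HasCofactor (suc j) μ

  FinalModulus : ℕ → Set
  FinalModulus μ = ∃[ c ] μ ≡ p ^ c ℕ* q

  HasCofactor-unique : ∀ {e e′ μ} → HasCofactor e μ → HasCofactor e′ μ → e ≡ e′
  HasCofactor-unique {e} {e′} (has-cofactor _ μ≡ p∤n _) (has-cofactor _ μ≡′ p∤n′ _) =
    proj₁ (^*-injective p-prime {e} {e′} p∤n p∤n′ (trans (sym μ≡) μ≡′))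

  HasCofactor⇒¬FinalModulus : ∀ {e μ} → HasCofactor e μ → ¬ FinalModulus μ
  HasCofactor⇒¬FinalModulus {e} (has-cofactor _ μ≡ p∤n n<q) (c , μ≡′)
    with _ , refl ← ^*-injective p-prime {e} {c} p∤n p∤q (trans (sym μ≡) μ≡′) =
    ℕₚ.<-irrefl refl n<q

  C₀-HasCofactor : All (HasCofactor 0 ∘ modulus) C₀
  C₀-HasCofactor = All.tabulate λ {c} c∈C₀ → let c∈cs , p∤m = ∈C₀⇒ c∈C₀ in
    has-cofactor (modulus c) (sym (ℕₚ.*-identityˡ (modulus c))) p∤m (modulus<q c∈cs)

  lift-HasCofactor : ∀ j → All (HasCofactor (suc j) ∘ modulus) (map (lift j) Cₚ)
  lift-HasCofactor j = AllP.map⁺ (All.tabulate λ {c} c∈Cₚ →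
    let c∈cs , p∣m = ∈Cₚ⇒ c∈Cₚ in
    has-cofactor (modulus c / p) (p^j*m≡p^[1+j]*[m/p] j p∣m) (p∤cofactor c∈Cₚ)
                 (ℕₚ.≤-<-trans (m/n≤m (modulus c) p) (modulus<q c∈cs)))

  C₀-unique : Unique (moduli C₀)
  C₀-unique = Unique-resp-⊆ (map⁺ modulus C₀⊆others) others-distinct

  lift-unique : ∀ j → Unique (moduli (map (lift j) Cₚ))
  lift-unique j =
    subst Unique (trans (sym (map-∘ Cₚ)) (map-∘ {g = modulus} {f = lift j} Cₚ))
    (UP.map⁺ (ℕₚ.*-cancelˡ-≡ _ _ (p ^ j) {{ℕₚ.m^n≢0 p j}})
             (Unique-resp-⊆ (map⁺ modulus Cₚ⊆others) others-distinct))

  levels-unique : ∀ k → Unique (moduli (levels k)) ×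
                        All (LevelModulus k ∘ modulus) (levels k)
  levels-unique zero    = [] , []
  levels-unique (suc k) with unique , shapes ← levels-unique k =
    Unique-map-++ {P = LevelModulus k} {Q = HasCofactor (suc k)} modulus
      unique (lift-unique k) shapes (lift-HasCofactor k)
      (λ (_ , j<k , has) has′ →
        ℕₚ.<-irrefl (ℕₚ.suc-injective (HasCofactor-unique has has′)) j<k) ,
    AllP.++⁺ (All.map (λ (j , j<k , has) → j , ℕₚ.m<n⇒m<1+n j<k , has) shapes)
             (All.map (λ has → k , ℕₚ.n<1+n k , has) (lift-HasCofactor k))

  finals-unique : Unique (moduli (map final (upTo q)))
  finals-unique = subst Unique (map-∘ (upTo q))
    (UP.map⁺ (proj₁ ∘ ^*-injective p-prime p∤q p∤q) (UP.upTo⁺ q))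

  finals-FinalModulus : All (FinalModulus ∘ modulus) (map final (upTo q))
  finals-FinalModulus = AllP.map⁺ {xs = upTo q} {f = final} (All.tabulate λ {c} _ → c , refl)

  system-unique : Unique (moduli system)
  system-unique =
    Unique-map-++ {P = HasCofactor 0} {Q = λ μ → LevelModulus q μ ⊎ FinalModulus μ} modulus
      C₀-unique rest-unique C₀-HasCofactor rest-shapes
      λ { has (inj₁ (_ , _ , has′)) → ℕₚ.0≢1+n (HasCofactor-unique has has′)
        ; has (inj₂ final-μ)       → HasCofactor⇒¬FinalModulus has final-μ }
    where
    rest-unique : Unique (moduli (levels q ++ map final (upTo q)))
    rest-unique = Unique-map-++ {P = LevelModulus q} {Q = FinalModulus} modulus
      (proj₁ (levels-unique q)) finals-unique (proj₂ (levels-unique q)) finals-FinalModulus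
      λ (_ , _ , has) → HasCofactor⇒¬FinalModulus has
    rest-shapes : All ((λ μ → LevelModulus q μ ⊎ FinalModulus μ) ∘ modulus)
                      (levels q ++ map final (upTo q))
    rest-shapes = AllP.++⁺ (All.map inj₁ (proj₂ (levels-unique q)))
                           (All.map inj₂ finals-FinalModulus)

  system-OddCovering : OddCovering system
  system-OddCovering = system-covers , system-OddAbove1 , system-unique

prime≥3⇒odd : ∀ {p} → Prime p → p ≥ 3 → Odd p
prime≥3⇒odd p-prime p≥3 2∣p with prime⇒irreducible p-prime 2∣p
... | inj₂ refl with s≤s (s≤s ()) ← p≥3

distinct-after-deleting : ∀ {p} cs → length (filter (ℕₚ._≟ p) (moduli cs)) ≡ 2 →
                          Unique (filter (λ m → ¬? (m ℕₚ.≟ p)) (moduli cs)) →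
                          ∃[ r ] Unique (moduli (filter (λ c → ¬? (c ≟ᶜ (r , p))) cs))
distinct-after-deleting {p} cs two distinct
  with m , m∈ ← length≡suc⇒∃∈ (filter (ℕₚ._≟ p) (moduli cs)) two
  with m∈moduli , refl ← ∈-filter⁻ (ℕₚ._≟ p) m∈
  with (r , _) , c∈cs , refl ← ∈-map⁻ modulus m∈moduli =
  r , Unique-if-rare ℕₚ._≟_ p _
        (ℕₚ.≤-pred (ℕₚ.<-≤-trans (count-delete< _≟ᶜ_ ℕₚ._≟_ modulus {xs = cs} c∈cs)
                                 (ℕₚ.≤-reflexive two)))
        (Unique-resp-⊆ (filter⁺ ≢p? ≢p? (λ { refl → id }) (map⁺ modulus (filter-⊆ ≢c? cs)))
                       distinct)
  where
  ≢p? : Decidable (λ m → m ≢ p)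
  ≢p? m = ¬? (m ℕₚ.≟ p)
  ≢c? : Decidable (λ c → c ≢ (r , p))
  ≢c? c = ¬? (c ≟ᶜ (r , p))

theorem3p2 : (p : ℕ) → Prime p → p ≥ 3
    → Σ (List Congruence) (SquareFreeCoveringWithPTwice p)
    → Σ (List Congruence) OddCovering
theorem3p2 p p-prime p≥3 (cs , covers , moduli-ok , two , distinct)
  with r₂ , others-distinct ← distinct-after-deleting cs two distinct =
  system , system-OddCovering
  where
  open Construction p-prime (prime≥3⇒odd p-prime p≥3) cs covers moduli-ok r₂ others-distinct
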